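{- Let $G$ be a graph without cycles of length $5$ and let $v\in V(G)$. Then $v$ is shedding if and only if $N_2(v)$ does not dominate $N(v)$.
   Context: Graphs are finite, simple, undirected; "without cycles of length 5" means $G$ has no cycle of length 5 as a subgraph. $N(v)$ is the neighbourhood of $v$, $N[v]=N(v)\cup\{v\}$, and $N_2(v)$ is the set of vertices at distance exactly $2$ from $v$. A set $S$ dominates a set $T$ if every vertex of $T$ belongs to $S$ or has a neighbour in $S$. A set is independent if its vertices are pairwise nonadjacent. A vertex $v$ is shedding if for every independent set $S\subseteq V(G)\setminus N[v]$ there exists $u\in N(v)$ such that $S\cup\{u\}$ is independent. -}

module Defs where

open import Data.Nat using (ℕ)
open import Data.Fin using (Fin)
open import Data.Fin.Subset using (Subset; _∈_; _∉_; _∪_; ⁅_⁆)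
open import Data.Sum using (_⊎_)
open import Relation.Nullary using (Dec)
open import Data.Product using (Σ; ∃; _×_; _,_)
open import Relation.Binary.PropositionalEquality using (_≡_)
open import Relation.Nullary using (¬_)

record Graph (n : ℕ) : Set₁ where
  field
    Adj      : Fin n → Fin n → Set
    adj?     : ∀ u v → Dec (Adj u v)
    irrefl   : ∀ v → ¬ Adj v v
    sym      : ∀ {u v} → Adj u v → Adj v u

open Graph public

module _ {n : ℕ} (G : Graph n) where

  HasC5 : Set
  HasC5 = Σ (Fin n) λ a → Σ (Fin n) λ b → Σ (Fin n) λ c → Σ (Fin n) λ d → Σ (Fin n) λ e →
            (¬ a ≡ b) × (¬ a ≡ c) × (¬ a ≡ d) × (¬ a ≡ e) ×
            (¬ b ≡ c) × (¬ b ≡ d) × (¬ b ≡ e) ×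
            (¬ c ≡ d) × (¬ c ≡ e) × (¬ d ≡ e) ×
            Adj G a b × Adj G b c × Adj G c d × Adj G d e × Adj G e a

  C5Free : Set
  C5Free = ¬ HasC5

  InN : Fin n → Fin n → Set
  InN v u = Adj G v u

  InClosedN : Fin n → Fin n → Set
  InClosedN v u = (u ≡ v) ⊎ Adj G v u

  InN₂ : Fin n → Fin n → Set
  InN₂ v u = (¬ u ≡ v) × (¬ Adj G v u) × (∃ λ w → Adj G v w × Adj G w u)

  Independent : Subset n → Set
  Independent S = ∀ x y → x ∈ S → y ∈ S → ¬ Adj G x y

  Dominates : (Fin n → Set) → (Fin n → Set) → Set
  Dominates S T = ∀ t → T t → S t ⊎ (∃ λ s → S s × Adj G t s)

  Shedding : Fin n → Set
  Shedding v = (S : Subset n) → Independent S → (∀ x → x ∈ S → ¬ InClosedN v x) →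
               ∃ λ u → InN v u × Independent (S ∪ ⁅ u ⁆)

-- If some t ∈ N(v) has no neighbour in N₂(v), then t can be added to every independent set
-- avoiding N[v], so v is shedding; this direction needs no hypothesis on cycles. Conversely,
-- if N₂(v) dominates N(v), take D ⊆ N₂(v) minimal among the sets dominating N(v). Each x ∈ D
-- has a private neighbour in N(v), so an edge xy inside D, with private neighbours a and b,
-- would give the 5-cycle v a x y b. Hence D is an independent set avoiding N[v] to which no
-- vertex of N(v) can be added, and v is not shedding.
module Submission where

open import Defs
open import Data.Nat using (ℕ)
open import Data.Fin using (Fin; _≟_)
open import Data.Fin.Properties using (any?; all?; ¬∀⟶∃¬)
open import Data.Fin.Subset using (Subset; _∈_; _⊆_; _⊂_; _∪_; ⁅_⁆; _-_)
open import Data.Fin.Subset.Properties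
  using (_∈?_; ⊆-refl; ⊆-trans; p─q⊆p; x∈p⇒p-x⊂p; x∈p∧x≢y⇒x∈p-y; x∈p∪q⁺; x∈p∪q⁻; x∈⁅x⁆; x∈⁅y⁆⇒x≡y)
open import Data.Fin.Subset.Induction using (⊂-wellFounded)
open import Data.Vec using (tabulate)
open import Data.Vec.Properties using (lookup∘tabulate; []=⇒lookup; lookup⇒[]=)
open import Data.Product using (∃; _×_; _,_; proj₁; proj₂)
open import Data.Sum using (inj₁; inj₂)
open import Function using (_∘_)
open import Function.Bundles using (_⇔_; mk⇔)
open import Induction.WellFounded using (Acc; acc)
open import Level using (Level)
open import Relation.Binary.PropositionalEquality using (_≡_; _≢_; refl; trans; ≢-sym)
  renaming (sym to ≡-sym)
open import Relation.Nullary using (¬_; yes; no; does; contradiction)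
open import Relation.Nullary.Decidable using (dec-true; _×-dec_; _→-dec_; ¬?)
open import Relation.Unary using (Pred; Decidable)

private
  variable
    ℓ : Level
    n : ℕ

module _ {P : Pred (Fin n) ℓ} (P? : Decidable P) where

  fromDec : Subset n
  fromDec = tabulate (does ∘ P?)

  ∈-fromDec⁺ : ∀ {x} → P x → x ∈ fromDec
  ∈-fromDec⁺ {x} px = lookup⇒[]= x fromDec (trans (lookup∘tabulate _ x) (dec-true (P? x) px))

  ∈-fromDec⁻ : ∀ {x} → x ∈ fromDec → P x
  ∈-fromDec⁻ {x} x∈ with P? x | trans (≡-sym (lookup∘tabulate (does ∘ P?) x)) ([]=⇒lookup x∈)
  ... | yes px | _ = px
  ... | no _   | ()

Minimal : Pred (Subset n) ℓ → Pred (Subset n) ℓ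
Minimal P D = ∀ x → x ∈ D → ¬ P (D - x)

minimal-⊆ : {P : Pred (Subset n) ℓ} → Decidable P →
            ∀ {D} → P D → ∃ λ D′ → D′ ⊆ D × P D′ × Minimal P D′
minimal-⊆ {P = P} P? pD = descend (⊂-wellFounded _) pD
  where
  descend : ∀ {D} → Acc _⊂_ D → P D → ∃ λ D′ → D′ ⊆ D × P D′ × Minimal P D′
  descend {D} (acc rs) pD with any? (λ x → (x ∈? D) ×-dec P? (D - x))
  ... | no irreducible = D , ⊆-refl , pD , λ x x∈D pD-x → irreducible (x , x∈D , pD-x)
  ... | yes (x , x∈D , pD-x) with descend (rs (x∈p⇒p-x⊂p x∈D)) pD-x
  ...   | D′ , D′⊆D-x , pD′ , minimal = D′ , ⊆-trans D′⊆D-x (p─q⊆p D ⁅ x ⁆) , pD′ , minimal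

module _ (G : Graph n) where

  Adj⇒≢ : ∀ {u w} → Adj G u w → u ≢ w
  Adj⇒≢ uw refl = irrefl G _ uw

  independent-∪-⁅⁆ : ∀ {S t} → Independent G S → (∀ y → y ∈ S → ¬ Adj G t y) →
                     Independent G (S ∪ ⁅ t ⁆)
  independent-∪-⁅⁆ {S} {t} indS t⊥S x y x∈ y∈ xy with x∈p∪q⁻ S ⁅ t ⁆ x∈ | x∈p∪q⁻ S ⁅ t ⁆ y∈
  ... | inj₁ x∈S | inj₁ y∈S = indS x y x∈S y∈S xy
  ... | inj₁ x∈S | inj₂ y∈t rewrite x∈⁅y⁆⇒x≡y t y∈t = t⊥S x x∈S (Graph.sym G xy)
  ... | inj₂ x∈t | inj₁ y∈S rewrite x∈⁅y⁆⇒x≡y t x∈t = t⊥S y y∈S xy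
  ... | inj₂ x∈t | inj₂ y∈t rewrite x∈⁅y⁆⇒x≡y t x∈t | x∈⁅y⁆⇒x≡y t y∈t = Adj⇒≢ xy refl

  NeighbourDominates : Pred (Fin n) ℓ → Pred (Subset n) ℓ
  NeighbourDominates T D = ∀ t → T t → ∃ λ s → s ∈ D × Adj G t s

  neighbourDominates? : {T : Pred (Fin n) ℓ} → Decidable T → Decidable (NeighbourDominates T)
  neighbourDominates? T? D = all? (λ t → T? t →-dec any? (λ s → (s ∈? D) ×-dec adj? G t s))

  undominated-vertex : {T : Pred (Fin n) ℓ} → Decidable T → ∀ {D} → ¬ NeighbourDominates T D →
                       ∃ λ t → T t × (∀ s → s ∈ D → ¬ Adj G t s)
  undominated-vertex T? {D} ¬dom
    with ¬∀⟶∃¬ n _ (λ t → T? t →-dec any? (λ s → (s ∈? D) ×-dec adj? G t s)) ¬dom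
  ... | t , ¬dominated with T? t
  ...   | no ¬Tt = contradiction (λ Tt → contradiction Tt ¬Tt) ¬dominated
  ...   | yes Tt = t , Tt , λ s s∈D ts → ¬dominated (λ _ → s , s∈D , ts)

  module _ {S T : Fin n → Set} (S? : Decidable S) where

    neighbourDominates⇒dominates : NeighbourDominates T (fromDec S?) → Dominates G S T
    neighbourDominates⇒dominates dom t Tt with dom t Tt
    ... | s , s∈S , ts = inj₂ (s , ∈-fromDec⁻ S? s∈S , ts)

    dominates⇒neighbourDominates : (∀ t → T t → ¬ S t) → Dominates G S T →
                                   NeighbourDominates T (fromDec S?)
    dominates⇒neighbourDominates T∩S=∅ dom t Tt with dom t Tt
    ... | inj₁ St = contradiction St (T∩S=∅ t Tt)
    ... | inj₂ (s , Ss , ts) = s , ∈-fromDec⁺ S? Ss , ts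

  private-neighbour : {T : Pred (Fin n) ℓ} → Decidable T →
                      ∀ {D} → NeighbourDominates T D → ∀ {x} → x ∈ D → ¬ NeighbourDominates T (D - x) →
                      ∃ λ a → T a × Adj G a x × (∀ s → s ∈ D → s ≢ x → ¬ Adj G a s)
  private-neighbour T? {D} dom {x} x∈D ¬dom-x with undominated-vertex T? ¬dom-x
  ... | a , Ta , a⊥D-x with dom a Ta
  ...   | s , s∈D , as with s ≟ x
  ...     | no s≢x   = contradiction as (a⊥D-x s (x∈p∧x≢y⇒x∈p-y s∈D s≢x))
  ...     | yes refl = a , Ta , as , λ s′ s′∈D s′≢x → a⊥D-x s′ (x∈p∧x≢y⇒x∈p-y s′∈D s′≢x)

  module _ (v : Fin n) where

    N₂? : Decidable (InN₂ G v)
    N₂? u = ¬? (u ≟ v) ×-dec ¬? (adj? G v u) ×-dec any? (λ w → adj? G v w ×-dec adj? G w u)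

    N₂⇒∉N[v] : ∀ {x} → InN₂ G v x → ¬ InClosedN G v x
    N₂⇒∉N[v] (x≢v , _ , _) (inj₁ x≡v) = x≢v x≡v
    N₂⇒∉N[v] (_ , ¬vx , _) (inj₂ vx)  = ¬vx vx

    ∉N[v]⇒N₂ : ∀ {t x} → Adj G v t → Adj G t x → ¬ InClosedN G v x → InN₂ G v x
    ∉N[v]⇒N₂ vt tx x∉N[v] = x∉N[v] ∘ inj₁ , x∉N[v] ∘ inj₂ , _ , vt , tx

    minimal-neighbourDominating⇒independent :
      C5Free G → ∀ {D} → (∀ x → x ∈ D → InN₂ G v x) →
      NeighbourDominates (InN G v) D → Minimal (NeighbourDominates (InN G v)) D → Independent G D
    minimal-neighbourDominating⇒independent c5free {D} D⊆N₂ dom minimal x y x∈D y∈D xy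
      with private-neighbour (adj? G v) dom x∈D (minimal x x∈D)
         | private-neighbour (adj? G v) dom y∈D (minimal y y∈D)
    ... | a , va , ax , a-private | b , vb , by , _ =
      c5free (v , a , x , y , b ,
              Adj⇒≢ va , ≢-sym x≢v , ≢-sym y≢v , Adj⇒≢ vb ,
              separated va ¬vx , separated va ¬vy , a≢b ,
              Adj⇒≢ xy , ≢-sym (separated vb ¬vx) , ≢-sym (separated vb ¬vy) ,
              va , ax , xy , Graph.sym G by , Graph.sym G vb)
      where
      x≢v : x ≢ v
      x≢v = proj₁ (D⊆N₂ x x∈D)
      y≢v : y ≢ v
      y≢v = proj₁ (D⊆N₂ y y∈D)
      ¬vx : ¬ Adj G v x
      ¬vx = proj₁ (proj₂ (D⊆N₂ x x∈D))
      ¬vy : ¬ Adj G v y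
      ¬vy = proj₁ (proj₂ (D⊆N₂ y y∈D))

      separated : ∀ {c z} → Adj G v c → ¬ Adj G v z → c ≢ z
      separated vc ¬vz refl = ¬vz vc

      a≢b : a ≢ b
      a≢b refl = a-private y y∈D (≢-sym (Adj⇒≢ xy)) by

    minimal-neighbourDominating⇒¬shedding :
      C5Free G → ∀ {D} → (∀ x → x ∈ D → InN₂ G v x) →
      NeighbourDominates (InN G v) D → Minimal (NeighbourDominates (InN G v)) D → ¬ Shedding G v
    minimal-neighbourDominating⇒¬shedding c5free {D} D⊆N₂ dom minimal shedding
      with shedding D (minimal-neighbourDominating⇒independent c5free D⊆N₂ dom minimal)
                      (λ x → N₂⇒∉N[v] ∘ D⊆N₂ x)
    ... | u , vu , D∪u-independent with dom u vu
    ...   | s , s∈D , us = D∪u-independent u s (x∈p∪q⁺ (inj₂ (x∈⁅x⁆ u))) (x∈p∪q⁺ (inj₁ s∈D)) us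

    dominates⇒¬shedding : C5Free G → Dominates G (InN₂ G v) (InN G v) → ¬ Shedding G v
    dominates⇒¬shedding c5free dom
      with minimal-⊆ (neighbourDominates? (adj? G v))
                     (dominates⇒neighbourDominates N₂? (λ t vt n₂ → proj₁ (proj₂ n₂) vt) dom)
    ... | D , D⊆N₂ , domD , minimal =
      minimal-neighbourDominating⇒¬shedding c5free (λ x → ∈-fromDec⁻ N₂? ∘ D⊆N₂) domD minimal

    ¬dominates⇒shedding : ¬ Dominates G (InN₂ G v) (InN G v) → Shedding G v
    ¬dominates⇒shedding ¬dom S S-independent S∩N[v]=∅
      with undominated-vertex (adj? G v) (¬dom ∘ neighbourDominates⇒dominates N₂?)
    ... | t , vt , t⊥N₂ =
      t , vt , independent-∪-⁅⁆ S-independent λ y y∈S ty →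
        t⊥N₂ y (∈-fromDec⁺ N₂? (∉N[v]⇒N₂ vt ty (S∩N[v]=∅ y y∈S))) ty

corollary5p2 : {n : ℕ} (G : Graph n) → C5Free G → (v : Fin n) →
    Shedding G v ⇔ (¬ Dominates G (InN₂ G v) (InN G v))
corollary5p2 G c5free v =
  mk⇔ (λ shedding dom → dominates⇒¬shedding G v c5free dom shedding) (¬dominates⇒shedding G v)
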